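{- Let $G$ be any finite simple graph with vertex set $\{x_1,\ldots,x_n\}$, and let $k_1,\ldots,k_n$ be integers with $k_i\ge 2$. Let $\widetilde G$ be the graph with vertex set $\{x_{i,j}: 1\le i\le n,\ 1\le j\le k_i\}$ and edge set $\{\{x_{i,1},x_{j,1}\}: \{x_i,x_j\}\in E(G)\}\cup\bigcup_{i=1}^n\{\{x_{i,j},x_{i,l}\}: 1\le j<l\le k_i\}$ (i.e. a clique of size $k_i$ is attached at each $x_i$). Then $\widetilde G$ is vertex decomposable and $\mathrm{Shed}(\widetilde G)$ is a dominating set of $\widetilde G$.
   Context: For a graph $G=(V,E)$ and $x\in V$, $G\setminus x$ is the graph obtained by deleting $x$ and its incident edges; $N(x)$ is the set of neighbours of $x$, $N[x]=N(x)\cup\{x\}$, and $G\setminus N[x]$ is obtained by deleting all vertices of $N[x]$ and their incident edges. A graph is well-covered if all its maximal independent sets have the same cardinality. A graph $G$ is vertex decomposable if $G$ is well-covered and either (i) $G$ has no edges (possibly no vertices), or (ii) there is a vertex $x$ such that both $G\setminus x$ and $G\setminus N[x]$ are vertex decomposable. For a vertex decomposable graph $G$, $\mathrm{Shed}(G)$ is the set of vertices $x$ such that $G\setminus x$ and $G\setminus N[x]$ are both vertex decomposable. A set $D\subseteq V$ is dominating if every vertex of $V\setminus D$ is adjacent to a vertex of $D$. -}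

module Defs where

open import Data.Bool using (Bool; true; false; not; _∨_; _∧_; if_then_else_)
open import Data.Nat using (ℕ; _≡ᵇ_)
open import Data.Fin using (Fin; toℕ)
open import Data.Fin.Properties renaming (_≟_ to _≟F_)
open import Data.List using (List; length; filterᵇ; concatMap; map; allFin)
open import Data.List.Membership.Propositional using (_∈_; _∉_)
open import Data.List.Relation.Unary.Unique.Propositional using (Unique)
open import Data.Product using (Σ; ∃; _×_; _,_)
open import Data.Product.Properties using (≡-dec)
open import Data.Sum using (_⊎_)
open import Relation.Binary.PropositionalEquality using (_≡_)
open import Relation.Binary.Definitions using (DecidableEquality)
open import Relation.Nullary.Decidable using (⌊_⌋)

-- A (simple) graph on vertex type V is given by a Bool-valued adjacency
-- relation; a (finite) vertex set is a duplicate-free list S of vertices,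
-- and the graph considered is the subgraph induced on S.
module GraphTheory {V : Set} (_≟_ : DecidableEquality V) (adj : V → V → Bool) where

  Independent : List V → List V → Set
  Independent S I = Unique I × (∀ v → v ∈ I → v ∈ S)
                    × (∀ u v → u ∈ I → v ∈ I → adj u v ≡ false)

  MaximalIndependent : List V → List V → Set
  MaximalIndependent S I = Independent S I
    × (∀ v → v ∈ S → v ∉ I → Σ V λ u → u ∈ I × adj u v ≡ true)

  WellCovered : List V → Set
  WellCovered S = ∀ I J → MaximalIndependent S I → MaximalIndependent S J
                  → length I ≡ length J

  NoEdges : List V → Set
  NoEdges S = ∀ u v → u ∈ S → v ∈ S → adj u v ≡ false

  delete : V → List V → List V
  delete x S = filterᵇ (λ v → not ⌊ v ≟ x ⌋) S

  deleteN : V → List V → List V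
  deleteN x S = filterᵇ (λ v → not (⌊ v ≟ x ⌋ ∨ adj x v)) S

  data VertexDecomposable : List V → Set where
    vd-empty : ∀ {S} → WellCovered S → NoEdges S → VertexDecomposable S
    vd-shed  : ∀ {S} (x : V) → x ∈ S → WellCovered S
             → VertexDecomposable (delete x S)
             → VertexDecomposable (deleteN x S)
             → VertexDecomposable S

  Shed : List V → V → Set
  Shed S x = x ∈ S × VertexDecomposable (delete x S) × VertexDecomposable (deleteN x S)

  Dominating : List V → (V → Set) → Set
  Dominating S D = (∀ v → D v → v ∈ S)
    × (∀ v → v ∈ S → D v ⊎ Σ V λ u → D u × adj u v ≡ true)

-- The graph G̃: vertex x_{i,j} is (i , j) with j : Fin (k i); j = 0 is x_{i,1}.
TVertex : (n : ℕ) → (Fin n → ℕ) → Set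
TVertex n k = Σ (Fin n) λ i → Fin (k i)

_≟T_ : ∀ {n k} → DecidableEquality (TVertex n k)
_≟T_ = ≡-dec _≟F_ _≟F_

isFirst : ∀ {m} → Fin m → Bool
isFirst j = toℕ j ≡ᵇ 0

tildeAdj : ∀ {n} (k : Fin n → ℕ) → (Fin n → Fin n → Bool) → TVertex n k → TVertex n k → Bool
tildeAdj k adj (i , j) (i' , j') =
  if ⌊ i ≟F i' ⌋ then not (toℕ j ≡ᵇ toℕ j')
  else (isFirst j ∧ isFirst j' ∧ adj i i')

tildeVertices : (n : ℕ) (k : Fin n → ℕ) → List (TVertex n k)
tildeVertices n k = concatMap (λ i → map (i ,_) (allFin (k i))) (allFin n)

-- Call x_{i,j} with j ≥ 2 a private vertex: its only neighbours lie in the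
-- clique of x_i.  Consider vertex sets S in which every clique met by S
-- still contains a private vertex of S.  A maximal independent set of such
-- an S takes exactly one vertex from each clique met by S (a missing clique
-- would leave its private vertex undominated), so S is well-covered.  The
-- property survives deleting x_{i,1}, which is not private, and deleting
-- N[x_{i,1}], which consists of clique i and non-private vertices only.
-- Once no x_{i,1} is left every vertex is private, and any vertex can be
-- shed.  This gives vertex decomposability by induction on |S|, with every
-- x_{i,1} in Shed(G̃); these dominate G̃ since each x_{i,j} lies in the clique
-- of x_{i,1}.
module Submission where

open import Defs
open import Data.Bool using (Bool; true; false; not; _∨_; T)
open import Data.Bool.Properties using (∧-zeroʳ; ¬-not) renaming (_≟_ to _≟B_)
open import Data.Nat using (ℕ; _≤_; _<_; s≤s; z≤n)
open import Data.Nat.Properties using (≤-trans) renaming (_≟_ to _≟ℕ_)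
open import Data.Nat.Induction using (Acc; acc; <-wellFounded)
open import Data.Fin using (Fin; toℕ; fromℕ<)
open import Data.Fin.Properties using (toℕ-injective; toℕ-fromℕ<) renaming (_≟_ to _≟F_)
open import Data.Product using (_×_; ∃-syntax; _,_; proj₁; proj₂)
open import Data.Sum using (_⊎_; inj₁; inj₂)
open import Data.List using (List; []; _∷_; length; map; allFin)
open import Data.List.Properties using (filter-notAll; length-map)
open import Data.List.Relation.Unary.Any as Any using (here; there; any?)
import Data.List.Relation.Unary.All as All
open import Data.List.Relation.Unary.Unique.Propositional using (Unique; []; _∷_)
open import Data.List.Membership.Propositional using (_∈_; find; lose)
open import Data.List.Membership.Propositional.Properties
  using (∈-map⁺; ∈-map⁻; ∈-filter⁺; ∈-filter⁻; ∈-concatMap⁺; ∈-allFin)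
open import Data.List.Membership.Propositional.Properties.WithK using (unique∧set⇒bag)
open import Data.List.Relation.Binary.BagAndSetEquality using (∼bag⇒↭)
open import Data.List.Relation.Binary.Permutation.Propositional using (_↭_)
open import Data.List.Relation.Binary.Permutation.Propositional.Properties using (↭-length)
open import Function using (_∘_)
open import Function.Bundles using (_⇔_; mk⇔)
open import Function.Properties.Equivalence using () renaming (sym to ⇔-sym; trans to ⇔-trans)
open import Relation.Binary.PropositionalEquality
  using (_≡_; _≢_; refl; sym; trans; cong; subst; module ≡-Reasoning)
open import Relation.Binary.Definitions using (DecidableEquality)
open import Relation.Nullary using (¬_; yes; no; contradiction)
open import Relation.Nullary.Decidable
  using (⌊_⌋; dec-false; decidable-stable; fromWitnessFalse; toWitnessFalse)

module _ {A B : Set} where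

  unique-map⁺ : (f : A → B) {xs : List A}
    → (∀ {x y} → x ∈ xs → y ∈ xs → f x ≡ f y → x ≡ y)
    → Unique xs → Unique (map f xs)
  unique-map⁺ f injective [] = []
  unique-map⁺ f {x ∷ xs} injective (x∉xs ∷ xs!) =
    All.tabulate fx≢ ∷ unique-map⁺ f (λ p q → injective (there p) (there q)) xs!
    where
      fx≢ : ∀ {z} → z ∈ map f xs → f x ≢ z
      fx≢ z∈ fx≡z with y , y∈ , refl ← ∈-map⁻ f z∈ =
        All.lookup x∉xs y∈ (injective (here refl) (there y∈) fx≡z)

T-not-∨⁻ : ∀ a b → T (not (a ∨ b)) → T (not a) × b ≡ false
T-not-∨⁻ false false _ = _ , refl

module GraphProperties {V : Set} (_≟_ : DecidableEquality V) (adj : V → V → Bool) where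
  open GraphTheory _≟_ adj

  ∈-delete⁺ : ∀ {x v S} → v ∈ S → v ≢ x → v ∈ delete x S
  ∈-delete⁺ {x} {v} v∈S v≢x = ∈-filter⁺ _ v∈S (fromWitnessFalse {a? = v ≟ x} v≢x)

  ∈-delete⁻ : ∀ {x v S} → v ∈ delete x S → v ∈ S × v ≢ x
  ∈-delete⁻ v∈ with v∈S , v≢x ← ∈-filter⁻ _ v∈ = v∈S , toWitnessFalse v≢x

  ∈-deleteN⁺ : ∀ {x v S} → v ∈ S → v ≢ x → adj x v ≡ false → v ∈ deleteN x S
  ∈-deleteN⁺ {x} {v} v∈S v≢x x≁v = ∈-filter⁺ _ v∈S keep
    where
      keep : T (not (⌊ v ≟ x ⌋ ∨ adj x v))
      keep with v ≟ x
      ... | yes v≡x = contradiction v≡x v≢x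
      ... | no _ rewrite x≁v = _

  ∈-deleteN⁻ : ∀ {x v S} → v ∈ deleteN x S → v ∈ S × v ≢ x × adj x v ≡ false
  ∈-deleteN⁻ {x} {v} v∈ with v∈S , keep ← ∈-filter⁻ _ v∈
    with v≢x , x≁v ← T-not-∨⁻ ⌊ v ≟ x ⌋ (adj x v) keep = v∈S , toWitnessFalse v≢x , x≁v

  delete-shorter : ∀ {x S} → x ∈ S → length (delete x S) < length S
  delete-shorter {x} {S} x∈S =
    filter-notAll _ S (Any.map (λ { refl kept → toWitnessFalse kept refl }) x∈S)

  deleteN-shorter : ∀ {x S} → x ∈ S → length (deleteN x S) < length S
  deleteN-shorter {x} {S} x∈S = filter-notAll _ S (Any.map removed x∈S)
    where
      removed : ∀ {v} → x ≡ v → ¬ T (not (⌊ v ≟ x ⌋ ∨ adj x v))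
      removed {v} refl kept = toWitnessFalse (proj₁ (T-not-∨⁻ ⌊ v ≟ x ⌋ (adj x v) kept)) refl

  vertexDecomposable-by : (P : List V → Set)
    → (∀ {S} → P S → WellCovered S)
    → (∀ {v S} → P (v ∷ S)
               → ∃[ x ] x ∈ v ∷ S × P (delete x (v ∷ S)) × P (deleteN x (v ∷ S)))
    → ∀ {S} → P S → VertexDecomposable S
  vertexDecomposable-by P wellCovered shed {S} = go S (<-wellFounded (length S))
    where
      go : ∀ S → Acc _<_ (length S) → P S → VertexDecomposable S
      go [] _ pS = vd-empty (wellCovered pS) (λ _ _ ())
      go (v ∷ S) (acc rs) pS with x , x∈ , p₁ , p₂ ← shed pS =
        vd-shed x x∈ (wellCovered pS)
          (go _ (rs (delete-shorter x∈)) p₁)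
          (go _ (rs (deleteN-shorter x∈)) p₂)

module WhiskeredGraph (n : ℕ) (adj : Fin n → Fin n → Bool) (k : Fin n → ℕ) where
  open GraphTheory (_≟T_ {n} {k}) (tildeAdj k adj)
  open GraphProperties (_≟T_ {n} {k}) (tildeAdj k adj)
  open import Data.List.Membership.DecPropositional (_≟T_ {n} {k}) using (_∈?_)

  Vertex : Set
  Vertex = TVertex n k

  _~_ : Vertex → Vertex → Bool
  _~_ = tildeAdj k adj

  First Private : ∀ {m} → Fin m → Set
  First j = isFirst j ≡ true
  Private j = isFirst j ≡ false

  private≢first : ∀ {i i'} {d : Fin (k i)} {c : Fin (k i')}
    → Private d → First c → (i , d) ≢ (i' , c)
  private≢first priv first refl with () ← trans (sym first) priv

  adjacent-inBlock : ∀ i {j j'} → j ≢ j' → (i , j) ~ (i , j') ≡ true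
  adjacent-inBlock i {j} {j'} j≢j' with i ≟F i
  ... | no i≢i = contradiction refl i≢i
  ... | yes _ = cong not (dec-false (toℕ j ≟ℕ toℕ j') (j≢j' ∘ toℕ-injective))

  nonadjacent-inBlock⇒≡ : ∀ i {j j'} → (i , j) ~ (i , j') ≡ false → j ≡ j'
  nonadjacent-inBlock⇒≡ i {j} {j'} i≁i = decidable-stable (j ≟F j') λ j≢j' →
    contradiction (trans (sym (adjacent-inBlock i j≢j')) i≁i) λ ()

  nonadjacent-private : ∀ {i i'} (j : Fin (k i)) (j' : Fin (k i'))
    → i ≢ i' → Private j' → (i , j) ~ (i' , j') ≡ false
  nonadjacent-private {i} {i'} j _ i≢i' priv with i ≟F i'
  ... | yes i≡i' = contradiction i≡i' i≢i'
  ... | no _ rewrite priv = ∧-zeroʳ (isFirst j)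

  nonadjacent-distinct⇒otherBlock : ∀ {i a} (c : Fin (k i)) (b : Fin (k a))
    → (i , c) ~ (a , b) ≡ false → (a , b) ≢ (i , c) → i ≢ a
  nonadjacent-distinct⇒otherBlock {i} c b x≁v v≢x refl =
    v≢x (cong (i ,_) (sym (nonadjacent-inBlock⇒≡ i x≁v)))

  adjacent-private⇒sameBlock : ∀ u {i} (c : Fin (k i))
    → u ~ (i , c) ≡ true → Private c → proj₁ u ≡ i
  adjacent-private⇒sameBlock (i' , j') {i} c u~v priv = decidable-stable (i' ≟F i) λ i'≢i →
    contradiction (trans (sym u~v) (nonadjacent-private j' c i'≢i priv)) λ ()

  PrivateInEveryBlock : List Vertex → Set
  PrivateInEveryBlock S = ∀ {i j} → (i , j) ∈ S → ∃[ c ] Private c × (i , c) ∈ S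

  independent-injectiveOnBlocks : ∀ {S I} → Independent S I
    → ∀ {u v} → u ∈ I → v ∈ I → proj₁ u ≡ proj₁ v → u ≡ v
  independent-injectiveOnBlocks (_ , _ , independent) {i , j} {_ , j'} u∈ v∈ refl =
    cong (i ,_) (nonadjacent-inBlock⇒≡ i (independent _ _ u∈ v∈))

  maximal-meets-block : ∀ {S I} → PrivateInEveryBlock S → MaximalIndependent S I
    → ∀ i → i ∈ map proj₁ I ⇔ (∃[ j ] (i , j) ∈ S)
  maximal-meets-block {S} {I} pieb ((_ , I⊆S , _) , maximal) i = mk⇔ toS fromS
    where
      toS : i ∈ map proj₁ I → ∃[ j ] (i , j) ∈ S
      toS i∈ with (_ , j) , v∈I , refl ← ∈-map⁻ proj₁ i∈ = j , I⊆S _ v∈I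

      fromS : ∃[ j ] (i , j) ∈ S → i ∈ map proj₁ I
      fromS (j , v∈S) with c , priv , c∈S ← pieb v∈S | (i , c) ∈? I
      ... | yes c∈I = ∈-map⁺ proj₁ c∈I
      ... | no c∉I with u , u∈I , u~c ← maximal (i , c) c∈S c∉I =
        subst (_∈ map proj₁ I) (adjacent-private⇒sameBlock u c u~c priv) (∈-map⁺ proj₁ u∈I)

  wellCovered : ∀ {S} → PrivateInEveryBlock S → WellCovered S
  wellCovered pieb I J maxI maxJ = begin
    length I             ≡⟨ length-map proj₁ I ⟨
    length (map proj₁ I) ≡⟨ ↭-length sameBlocks ⟩
    length (map proj₁ J) ≡⟨ length-map proj₁ J ⟩
    length J             ∎
    where
      open ≡-Reasoning
      blocks-unique : ∀ {K} → MaximalIndependent _ K → Unique (map proj₁ K)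
      blocks-unique (indep@(K! , _) , _) = unique-map⁺ proj₁ (independent-injectiveOnBlocks indep) K!

      sameBlocks : map proj₁ I ↭ map proj₁ J
      sameBlocks = ∼bag⇒↭ (unique∧set⇒bag (blocks-unique maxI) (blocks-unique maxJ) λ {i} →
        ⇔-trans (maximal-meets-block pieb maxI i) (⇔-sym (maximal-meets-block pieb maxJ i)))

  delete-first : ∀ {S i c} → PrivateInEveryBlock S → First c → PrivateInEveryBlock (delete (i , c) S)
  delete-first pieb first v∈ with v∈S , _ ← ∈-delete⁻ v∈ with d , priv , d∈S ← pieb v∈S =
    d , priv , ∈-delete⁺ d∈S (private≢first priv first)

  deleteN-first : ∀ {S i c} → PrivateInEveryBlock S → First c
    → PrivateInEveryBlock (deleteN (i , c) S)
  deleteN-first {c = c} pieb first {j = b} v∈ with v∈S , v≢x , x≁v ← ∈-deleteN⁻ v∈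
    with d , priv , d∈S ← pieb v∈S =
    d , priv , ∈-deleteN⁺ d∈S (private≢first priv first)
                 (nonadjacent-private c d (nonadjacent-distinct⇒otherBlock c b x≁v v≢x) priv)

  AllPrivate : List Vertex → Set
  AllPrivate S = ∀ {v} → v ∈ S → Private (proj₂ v)

  allPrivate⇒privateInEveryBlock : ∀ {S} → AllPrivate S → PrivateInEveryBlock S
  allPrivate⇒privateInEveryBlock allPrivate v∈ = _ , allPrivate v∈ , v∈

  sheddingVertex : ∀ {v S} → PrivateInEveryBlock (v ∷ S)
    → ∃[ x ] x ∈ v ∷ S × PrivateInEveryBlock (delete x (v ∷ S))
                      × PrivateInEveryBlock (deleteN x (v ∷ S))
  sheddingVertex {v} {S} pieb with any? (λ u → isFirst (proj₂ u) ≟B true) (v ∷ S)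
  ... | yes someFirst with (i , c) , x∈ , first ← find someFirst =
    (i , c) , x∈ , delete-first pieb first , deleteN-first pieb first
  ... | no noFirst =
    v , here refl , allPrivate⇒privateInEveryBlock (allPrivate ∘ proj₁ ∘ ∈-delete⁻)
                  , allPrivate⇒privateInEveryBlock (allPrivate ∘ proj₁ ∘ ∈-deleteN⁻)
    where
      allPrivate : AllPrivate (v ∷ S)
      allPrivate v∈ = ¬-not (noFirst ∘ lose v∈)

  vertexDecomposable : ∀ {S} → PrivateInEveryBlock S → VertexDecomposable S
  vertexDecomposable = vertexDecomposable-by PrivateInEveryBlock wellCovered sheddingVertex

  first∈Shed : ∀ {S i c} → PrivateInEveryBlock S → (i , c) ∈ S → First c → Shed S (i , c)
  first∈Shed pieb x∈ first =
    x∈ , vertexDecomposable (delete-first pieb first) , vertexDecomposable (deleteN-first pieb first)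

  ∈-tildeVertices : ∀ i j → (i , j) ∈ tildeVertices n k
  ∈-tildeVertices i j = ∈-concatMap⁺ (λ i → map (i ,_) (allFin (k i)))
    (Any.map (λ { refl → ∈-map⁺ (i ,_) (∈-allFin j) }) (∈-allFin i))

  module _ (k≥2 : ∀ i → 2 ≤ k i) where

    firstVertex privateVertex : ∀ i → Fin (k i)
    firstVertex i = fromℕ< (≤-trans (s≤s z≤n) (k≥2 i))
    privateVertex i = fromℕ< (k≥2 i)

    first-firstVertex : ∀ i → First (firstVertex i)
    first-firstVertex i rewrite toℕ-fromℕ< (≤-trans (s≤s z≤n) (k≥2 i)) = refl

    private-privateVertex : ∀ i → Private (privateVertex i)
    private-privateVertex i rewrite toℕ-fromℕ< (k≥2 i) = refl

    tildeVertices-privateInEveryBlock : PrivateInEveryBlock (tildeVertices n k)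
    tildeVertices-privateInEveryBlock {i} _ = privateVertex i , private-privateVertex i , ∈-tildeVertices i _

    shed-dominating : Dominating (tildeVertices n k) (Shed (tildeVertices n k))
    shed-dominating = (λ _ → proj₁) , dominated
      where
        firstShed : ∀ {i j} → First j → Shed (tildeVertices n k) (i , j)
        firstShed {i} {j} = first∈Shed tildeVertices-privateInEveryBlock (∈-tildeVertices i j)

        dominated : ∀ v → v ∈ tildeVertices n k
          → Shed (tildeVertices n k) v ⊎ ∃[ u ] Shed (tildeVertices n k) u × u ~ v ≡ true
        dominated (i , j) _ with isFirst j ≟B true
        ... | yes first = inj₁ (firstShed first)
        ... | no ¬first =
          inj₂ ((i , firstVertex i) , firstShed (first-firstVertex i) , adjacent-inBlock i first≢j)
          where
            first≢j : firstVertex i ≢ j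
            first≢j e = private≢first (¬-not ¬first) (first-firstVertex i) (cong (i ,_) (sym e))

theorem3p1 : (n : ℕ) (adj : Fin n → Fin n → Bool)
    → (∀ i j → adj i j ≡ adj j i) → (∀ i → adj i i ≡ false)
    → (k : Fin n → ℕ) → (∀ i → 2 ≤ k i)
    → let open GraphTheory (_≟T_ {n} {k}) (tildeAdj k adj) in
    VertexDecomposable (tildeVertices n k)
    × Dominating (tildeVertices n k) (Shed (tildeVertices n k))
theorem3p1 n adj _ _ k k≥2 =
  vertexDecomposable (tildeVertices-privateInEveryBlock k≥2) , shed-dominating k≥2
  where open WhiskeredGraph n adj k
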